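{- Let $F=\mathrm{Tr}_{\mathbb N}\times\mathbb N^*$ with transition relation $\overline{\prec}$ as defined below. For each Borel set $Q\subseteq F$, the set $\langle l\rangle Q=\{x\in F:\exists y\in Q,\ x\,\overline{\prec}\,y\}$ is Borel. Hence $\mathcal F=(F,\mathcal B(F),\overline{\prec})$ is a measurable labelled transition system.
   Context: $\mathbb N^*$ denotes the set of finite sequences of natural numbers with the discrete topology; $s\prec s'$ means $s'=s^\frown n$ for some $n\in\mathbb N$. A tree on $\mathbb N$ is a prefix-closed subset of $\mathbb N^*$; $\mathrm{Tr}_{\mathbb N}$ is the set of all trees, a closed subspace of $2^{\mathbb N^*}$ (product topology). $F=\mathrm{Tr}_{\mathbb N}\times\mathbb N^*$ carries the product topology and its Borel $\sigma$-algebra $\mathcal B(F)$. There is a single label $l$, and $(T,s)\,\overline{\prec}\,(T',s')$ iff $T=T'$, $s,s'\in T$ and $s\prec s'$; write $\overline{\prec}(T,s)=\{(T,s'): s,s'\in T,\ s\prec s'\}$. A measurable labelled transition system (MLTS) is a tuple $(S,\Sigma,\{\tilde T_a:a\in L\})$ with $(S,\Sigma)$ a measurable space and each $\tilde T_a:S\to\Sigma$ measurable with respect to the $\sigma$-algebra $H(\Sigma)$ on $\Sigma$ generated by the sets $\{\zeta\in\Sigma:\zeta\cap\xi\neq\emptyset\}$, $\xi\in\Sigma$; equivalently, each $\tilde T_a(s)\in\Sigma$ and for all $Q\in\Sigma$ the set $\{s:\tilde T_a(s)\cap Q\ne\emptyset\}$ belongs to $\Sigma$. -}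

module Defs where


open import Data.Nat using (ℕ)
open import Data.Bool using (Bool; true)
open import Data.List using (List; _++_; [_])
open import Data.List.Membership.Propositional using (_∈_)
open import Data.Product using (Σ; ∃; _×_; _,_; proj₁; proj₂)
open import Relation.Binary.PropositionalEquality using (_≡_)
open import Relation.Nullary using (¬_)

ℕ* : Set
ℕ* = List ℕ

_≺_ : ℕ* → ℕ* → Set
s ≺ s' = ∃ λ (n : ℕ) → s' ≡ s ++ [ n ]

2^ℕ* : Set
2^ℕ* = ℕ* → Bool

_∈T_ : ℕ* → 2^ℕ* → Set
s ∈T T = T s ≡ true

IsTree : 2^ℕ* → Set
IsTree T = ∀ (s t : ℕ*) → (s ++ t) ∈T T → s ∈T T

Tr : Set
Tr = Σ 2^ℕ* IsTree

F : Set
F = Tr × ℕ*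

Subset : Set₁
Subset = F → Set

_⊆_ : Subset → Subset → Set
A ⊆ B = ∀ x → A x → B x

_≐_ : Subset → Subset → Set
A ≐ B = (A ⊆ B) × (B ⊆ A)

-- Basic open sets of F (product of the subspace topology on Tr_ℕ ⊆ 2^{ℕ*},
-- with product topology on 2^{ℕ*}, and the discrete topology on ℕ*):
-- a finite list of coordinate constraints (u , b) on the tree, and a fixed sequence s₀.
BasicOpen : List (ℕ* × Bool) → ℕ* → Subset
BasicOpen cs s₀ ((T , _) , s) =
  (∀ {c} → c ∈ cs → T (proj₁ c) ≡ proj₂ c) × (s ≡ s₀)

IsOpen : Subset → Set
IsOpen U = ∀ x → U x →
  ∃ λ (cs : List (ℕ* × Bool)) → ∃ λ (s₀ : ℕ*) →
    BasicOpen cs s₀ x × (BasicOpen cs s₀ ⊆ U)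

-- Borel σ-algebra B(F): the least family of subsets containing the open sets
-- and closed under complement and countable unions (and extensional equality
-- of subsets, since subsets are predicates).
data Borel : Subset → Set₁ where
  open-borel  : ∀ {U} → IsOpen U → Borel U
  compl-borel : ∀ {A} → Borel A → Borel (λ x → ¬ A x)
  union-borel : ∀ {A : ℕ → Subset} → (∀ n → Borel (A n)) →
                Borel (λ x → ∃ λ n → A n x)
  ext-borel   : ∀ {A B} → A ≐ B → Borel A → Borel B

_≈Tr_ : Tr → Tr → Set
T ≈Tr T' = ∀ u → proj₁ T u ≡ proj₁ T' u

_⊰_ : F → F → Set
(T , s) ⊰ (T' , s') = (T ≈Tr T') × (s ∈T proj₁ T) × (s' ∈T proj₁ T) × (s ≺ s')

⊰[_] : F → Subset
⊰[ x ] y = x ⊰ y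

⟨l⟩ : Subset → Subset
⟨l⟩ Q x = ∃ λ y → Q y × (x ⊰ y)

-- MLTS with a single label l on a type S with a σ-algebra (given by its
-- membership predicate Meas) and transition relation R :
-- each R(x) is measurable and {x : R(x) ∩ Q ≠ ∅} is measurable for measurable Q.
IsMLTS : {S : Set} → ((S → Set) → Set₁) → (S → S → Set) → Set₁
IsMLTS {S} Meas R =
  (∀ (x : S) → Meas (λ y → R x y)) ×
  (∀ (Q : S → Set) → Meas Q → Meas (λ x → ∃ λ y → Q y × R x y))

module Submission where

-- Both parts of the theorem follow by writing the relevant set as a countable
-- union, indexed by the last letter n of the successor sequence, of sets that
-- are visibly Borel.
--
--  * ⟨l⟩ Q = ⋃ₙ (Aₙ ∩ shiftₙ⁻¹ Q), where Aₙ = {(T,s) : s ∈ T, s⁀n ∈ T} is a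
--    decidable open set and shiftₙ (T,s) = (T, s⁀n) is continuous.  Replacing
--    the witness's tree by the (pointwise equal) current tree is allowed since
--    every Borel set is invariant under pointwise equality of trees.
--  * ⊰[(T,s)] = ⋃ₙ (Cₙ ∩ {y : tree of y ≈ T}), where Cₙ only constrains the
--    sequence coordinate (hence is decidable open, ℕ* being discrete) and
--    {y : tree of y ≈ T} is the complement of the open set of trees that
--    differ from T at some coordinate.

open import Defs
open import Data.Nat using (ℕ; zero; suc)
import Data.Nat.Properties as ℕ
open import Data.Bool using (Bool; true)
import Data.Bool.Properties as Bool
open import Data.List using (List; []; _∷_; _++_; [_])
import Data.List.Properties as List
open import Data.List.Membership.Propositional using (_∈_)
open import Data.List.Membership.Propositional.Properties using (∈-++⁺ˡ; ∈-++⁺ʳ; ∈-++⁻)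
open import Data.List.Relation.Unary.Any using (here; there)
open import Data.Product using (∃; _×_; _,_; proj₁; proj₂)
open import Data.Sum using (_⊎_; inj₁; inj₂)
open import Data.Empty using (⊥-elim)
open import Relation.Nullary using (¬_; Dec; yes; no)
open import Relation.Nullary.Decidable.Core using (_×-dec_)
open import Relation.Binary.PropositionalEquality using (_≡_; refl; sym; trans)

tree : F → 2^ℕ*
tree x = proj₁ (proj₁ x)

-- A binary union is the countable union of the sequence A, B, B, B, …
union₂-borel : ∀ {A B} → Borel A → Borel B → Borel (λ x → A x ⊎ B x)
union₂-borel {A} {B} bA bB = ext-borel (to , from) (union-borel {A = seq} seq-borel)
  where
  seq : ℕ → Subset
  seq zero    = A
  seq (suc _) = B
  seq-borel : ∀ n → Borel (seq n)
  seq-borel zero    = bA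
  seq-borel (suc _) = bB
  to : ∀ x → (∃ λ n → seq n x) → A x ⊎ B x
  to x (zero  , a) = inj₁ a
  to x (suc _ , b) = inj₂ b
  from : ∀ x → A x ⊎ B x → ∃ λ n → seq n x
  from x (inj₁ a) = 0 , a
  from x (inj₂ b) = 1 , b

-- The intersection of two basic open sets with the same sequence coordinate is
-- the basic open set given by the concatenated constraint list.
open-∩ : ∀ {A U} → IsOpen A → IsOpen U → IsOpen (λ x → A x × U x)
open-∩ {A} {U} oA oU x (a , u) with oA x a | oU x u
... | cs₁ , s₁ , (c₁ , e₁) , ⊆A | cs₂ , s₂ , (c₂ , e₂) , ⊆U =
  cs₁ ++ cs₂ , s₁ , (both , e₁) , ⊆A∩U
  where
  both : ∀ {c} → c ∈ cs₁ ++ cs₂ → tree x (proj₁ c) ≡ proj₂ c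
  both m with ∈-++⁻ cs₁ m
  ... | inj₁ m₁ = c₁ m₁
  ... | inj₂ m₂ = c₂ m₂
  ⊆A∩U : BasicOpen (cs₁ ++ cs₂) s₁ ⊆ (λ y → A y × U y)
  ⊆A∩U y (c , e) =
    ⊆A y ((λ m → c (∈-++⁺ˡ m)) , e) ,
    ⊆U y ((λ m → c (∈-++⁺ʳ cs₁ m)) , trans e (trans (sym e₁) e₂))

-- Since F carries the discrete topology in its sequence coordinate, every set
-- depending only on that coordinate is open (witnessed by the empty constraint).
sequence-open : (P : ℕ* → Set) → IsOpen (λ y → P (proj₂ y))
sequence-open P x p = [] , proj₂ x , ((λ ()) , refl) , λ { y (_ , refl) → p }

-- For a complement, A ∩ ¬B = ¬(¬A ∪ (A ∩ B)), where
-- the direction ⊆ needs A to be decidable.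
module _ {A : Subset} (oA : IsOpen A) (A? : ∀ x → Dec (A x)) where

  ∩-borel : ∀ {B} → Borel B → Borel (λ x → A x × B x)
  ∩-borel (open-borel oB) = open-borel (open-∩ oA oB)
  ∩-borel (compl-borel {B} bB) =
    ext-borel (to , from)
      (compl-borel (union₂-borel (compl-borel (open-borel oA)) (∩-borel bB)))
    where
    to : ∀ x → ¬ (¬ A x ⊎ (A x × B x)) → A x × ¬ B x
    to x h with A? x
    ... | yes a = a , λ b → h (inj₂ (a , b))
    ... | no ¬a = ⊥-elim (h (inj₁ ¬a))
    from : ∀ x → A x × ¬ B x → ¬ (¬ A x ⊎ (A x × B x))
    from x (a , _ ) (inj₁ ¬a)    = ¬a a
    from x (_ , ¬b) (inj₂ (_ , b)) = ¬b b
  ∩-borel (union-borel bB) =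
    ext-borel ((λ _ (a , n , b) → n , a , b) , (λ _ (n , a , b) → a , n , b))
      (union-borel (λ n → ∩-borel (bB n)))
  ∩-borel (ext-borel (f , g) bB) =
    ext-borel ((λ x (a , b) → a , f x b) , (λ x (a , b) → a , g x b)) (∩-borel bB)

Continuous : (F → F) → Set₁
Continuous f = ∀ U → IsOpen U → IsOpen (λ x → U (f x))

-- Preimages of Borel sets under continuous maps are Borel, since taking
-- preimages commutes with complements and countable unions.
preimage-borel : ∀ {f} → Continuous f → ∀ {Q} → Borel Q → Borel (λ x → Q (f x))
preimage-borel cf (open-borel oU)       = open-borel (cf _ oU)
preimage-borel cf (compl-borel bQ)      = compl-borel (preimage-borel cf bQ)
preimage-borel cf (union-borel bQ)      = union-borel (λ n → preimage-borel cf (bQ n))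
preimage-borel cf (ext-borel (f , g) bQ) =
  ext-borel ((λ x → f _) , (λ x → g _)) (preimage-borel cf bQ)

-- Borel sets cannot distinguish pointwise equal trees: basic open sets only
-- look at the values of the characteristic function.
borel-respects-≈Tr : ∀ {Q} → Borel Q → ∀ {T T' s} → T ≈Tr T' → Q (T , s) → Q (T' , s)
borel-respects-≈Tr (open-borel oU) T≈T' q with oU _ q
... | cs , s₀ , (c , e) , ⊆U = ⊆U _ ((λ m → trans (sym (T≈T' _)) (c m)) , e)
borel-respects-≈Tr (compl-borel bQ) T≈T' ¬q q' =
  ¬q (borel-respects-≈Tr bQ (λ u → sym (T≈T' u)) q')
borel-respects-≈Tr (union-borel bQ) T≈T' (n , q) = n , borel-respects-≈Tr (bQ n) T≈T' q
borel-respects-≈Tr (ext-borel (f , g) bQ) T≈T' q = f _ (borel-respects-≈Tr bQ T≈T' (g _ q))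

shift : ℕ → F → F
shift n (T , s) = T , s ++ [ n ]

-- shift n is continuous: a basic neighbourhood of shift n (T,s) pulls back to
-- the basic neighbourhood of (T,s) with the same tree constraints.
shift-continuous : ∀ n → Continuous (shift n)
shift-continuous n U oU (T , s) u with oU _ u
... | cs , s₀ , (c , e) , ⊆U = cs , s , (c , refl) , λ { (T' , _) (c' , refl) → ⊆U _ (c' , e) }

HasSucc : ℕ → Subset
HasSucc n x = tree x (proj₂ x) ≡ true × tree x (proj₂ x ++ [ n ]) ≡ true

HasSucc-open : ∀ n → IsOpen (HasSucc n)
HasSucc-open n (T , s) (a , b) = constraints , s , (holds , refl) , ⊆HasSucc
  where
  constraints : List (ℕ* × Bool)
  constraints = (s , true) ∷ (s ++ [ n ] , true) ∷ []
  holds : ∀ {c} → c ∈ constraints → proj₁ T (proj₁ c) ≡ proj₂ c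
  holds (here refl)         = a
  holds (there (here refl)) = b
  ⊆HasSucc : BasicOpen constraints s ⊆ HasSucc n
  ⊆HasSucc y (c , refl) = c (here refl) , c (there (here refl))

HasSucc? : ∀ n x → Dec (HasSucc n x)
HasSucc? n x = (tree x (proj₂ x) Bool.≟ true) ×-dec (tree x (proj₂ x ++ [ n ]) Bool.≟ true)

⟨l⟩-borel : ∀ (Q : Subset) → Borel Q → Borel (⟨l⟩ Q)
⟨l⟩-borel Q bQ =
  ext-borel (to , from)
    (union-borel (λ n → ∩-borel (HasSucc-open n) (HasSucc? n)
                          (preimage-borel (shift-continuous n) bQ)))
  where
  to : ∀ x → (∃ λ n → HasSucc n x × Q (shift n x)) → ⟨l⟩ Q x
  to (T , s) (n , (a , b) , q) = shift n (T , s) , q , (λ _ → refl) , a , b , n , refl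
  from : ∀ x → ⟨l⟩ Q x → ∃ λ n → HasSucc n x × Q (shift n x)
  from (T , s) ((T' , _) , q , T≈T' , a , b , n , refl) =
    n , (a , b) , borel-respects-≈Tr bQ (λ u → sym (T≈T' u)) q

DiffersFrom : Tr → Subset
DiffersFrom T y = ∃ λ u → ¬ (tree y u ≡ proj₁ T u)

DiffersFrom-open : ∀ T → IsOpen (DiffersFrom T)
DiffersFrom-open T (T' , s') (u , ≢) = (u , proj₁ T' u) ∷ [] , s' , (holds , refl) , ⊆Differs
  where
  holds : ∀ {c} → c ∈ (u , proj₁ T' u) ∷ [] → proj₁ T' (proj₁ c) ≡ proj₂ c
  holds (here refl) = refl
  ⊆Differs : BasicOpen ((u , proj₁ T' u) ∷ []) s' ⊆ DiffersFrom T
  ⊆Differs y (c , _) = u , λ e → ≢ (trans (sym (c (here refl))) e)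

¬DiffersFrom⇒≈Tr : ∀ T y → ¬ DiffersFrom T y → T ≈Tr proj₁ y
¬DiffersFrom⇒≈Tr T y ¬d u with proj₁ T u Bool.≟ tree y u
... | yes eq = eq
... | no ≢   = ⊥-elim (¬d (u , λ eq → ≢ (sym eq)))

module _ (x : F) where
  private
    T = proj₁ x
    s = proj₂ x

  SuccSeq : ℕ → ℕ* → Set
  SuccSeq n s' = s' ≡ s ++ [ n ] × proj₁ T s ≡ true × proj₁ T (s ++ [ n ]) ≡ true

  SuccSeq? : ∀ n s' → Dec (SuccSeq n s')
  SuccSeq? n s' = List.≡-dec ℕ._≟_ s' (s ++ [ n ])
    ×-dec ((proj₁ T s Bool.≟ true) ×-dec (proj₁ T (s ++ [ n ]) Bool.≟ true))

  successors-borel : Borel ⊰[ x ]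
  successors-borel =
    ext-borel (to , from)
      (union-borel (λ n → ∩-borel (sequence-open (SuccSeq n)) (λ y → SuccSeq? n (proj₂ y))
                            (compl-borel (open-borel (DiffersFrom-open T)))))
    where
    to : ∀ y → (∃ λ n → SuccSeq n (proj₂ y) × ¬ DiffersFrom T y) → x ⊰ y
    to y (n , (refl , a , b) , ¬d) = ¬DiffersFrom⇒≈Tr T y ¬d , a , b , n , refl
    from : ∀ y → x ⊰ y → ∃ λ n → SuccSeq n (proj₂ y) × ¬ DiffersFrom T y
    from y (T≈T' , a , b , n , refl) = n , (refl , a , b) , λ (u , ≢) → ≢ (sym (T≈T' u))

mainTheorem7 : (∀ (Q : Subset) → Borel Q → Borel (⟨l⟩ Q)) × IsMLTS Borel _⊰_
mainTheorem7 = ⟨l⟩-borel , successors-borel , ⟨l⟩-borel
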